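{- Let $G$ be a graph, $X_1,X_2\subseteq V(G)$ with $X_1\cap X_2=\emptyset$, let $(\bar a_1,\bar b_1)$ be an ordered split pair for $X_1$ and $(\bar a_2,\bar b_2)$ an ordered split pair for $X_2$ such that $X_1\cap\bar b_2\subseteq\bar a_1$. Let $v,w\in X_1$ with $v\approx_{(\bar a_1,\bar b_1)}w$. Then $v\approx_{(\bar a_2,\bar b_2)}w$.
   Context: Graphs are finite, simple, undirected; $N(v)$ is the neighbourhood and $\overline Y=V(G)\setminus Y$. For $v\in Y$, $\mathbf x_Y(v)\in\mathbb F_2^{\overline Y}$ has $w$-entry $1$ iff $vw\in E(G)$. A split pair for $Y$ is $(A,B)$ with $A\subseteq Y$, $B\subseteq\overline Y$, $\{\mathbf x_Y(a)\mid a\in A\}$ a basis of the $\mathbb F_2$-span of $\{\mathbf x_Y(v)\mid v\in Y\}$ and $\{\mathbf x_{\overline Y}(b)\mid b\in B\}$ a basis of the span of $\{\mathbf x_{\overline Y}(v)\mid v\in\overline Y\}$; an ordered split pair is a pair of tuples whose entry sets form a split pair. Tuples are identified with their sets of entries in set expressions. $v\approx_{(\bar a,\bar b)}w$ means $v$ and $w$ have the same neighbours among the entries of $\bar a$ and $\bar b$. -}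

module Defs where

open import Data.Nat using (ℕ; zero; suc)
open import Data.Fin using (Fin; zero; suc)
open import Data.Bool using (Bool; true; false; not; _∧_; _xor_)
open import Data.List using (List)
open import Data.List.Membership.Propositional using (_∈_)
open import Data.Product using (Σ; _×_; ∃-syntax)
open import Data.Sum using (_⊎_)
open import Relation.Binary.PropositionalEquality using (_≡_; _≢_)

record Graph (n : ℕ) : Set where
  field
    adj   : Fin n → Fin n → Bool
    sym   : ∀ u v → adj u v ≡ adj v u
    irrfl : ∀ v → adj v v ≡ false
open Graph public

VSet : ℕ → Set
VSet n = Fin n → Bool

compl : ∀ {n} → VSet n → VSet n
compl Y v = not (Y v)

-- Vectors in F₂^Ȳ, represented as vectors in F₂^V(G) that vanish outside Ȳ
-- (the embedding F₂^Ȳ ↪ F₂^V by extension by zero).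
Vec₂ : ℕ → Set
Vec₂ n = Fin n → Bool

xvec : ∀ {n} → Graph n → VSet n → Fin n → Vec₂ n
xvec G Y v w = not (Y w) ∧ adj G v w

⊕ : ∀ {k} → (Fin k → Bool) → Bool
⊕ {zero}  f = false
⊕ {suc k} f = f zero xor ⊕ (λ i → f (suc i))

lincomb : ∀ {n} → (Fin n → Bool) → (Fin n → Vec₂ n) → Vec₂ n
lincomb c f w = ⊕ (λ u → c u ∧ f u w)

SupportedOn : ∀ {n} → (Fin n → Bool) → (Fin n → Set) → Set
SupportedOn c P = ∀ u → c u ≡ true → P u

InSpan : ∀ {n} → (Fin n → Set) → (Fin n → Vec₂ n) → Vec₂ n → Set
InSpan P f z = ∃[ c ] (SupportedOn c P × (∀ w → lincomb c f w ≡ z w))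

-- The SET {f(a) | P a} is linearly independent: every sum of finitely many
-- distinct elements of it (chosen via indices with pairwise distinct vectors)
-- is nonzero unless the selection is empty.
SetIndependent : ∀ {n} → (Fin n → Set) → (Fin n → Vec₂ n) → Set
SetIndependent P f =
  ∀ c → SupportedOn c P
      → (∀ u u' → c u ≡ true → c u' ≡ true → u ≢ u' → ∃[ w ] (f u w ≢ f u' w))
      → (∀ w → lincomb c f w ≡ false)
      → ∀ u → c u ≡ false

-- {f(a) | P a} is a basis of the F₂-span of {f(v) | Q v}
-- (given P ⊆ Q, membership of the f(a) in that span is automatic).
IsBasisOfSpan : ∀ {n} → (Fin n → Set) → (Fin n → Set) → (Fin n → Vec₂ n) → Set
IsBasisOfSpan P Q f =
  (∀ v → Q v → InSpan P f (f v)) × SetIndependent P f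

Entry : ∀ {n} → List (Fin n) → Fin n → Set
Entry t u = u ∈ t

SplitPair : ∀ {n} → Graph n → VSet n → (Fin n → Set) → (Fin n → Set) → Set
SplitPair G Y A B =
  (∀ a → A a → Y a ≡ true) ×
  (∀ b → B b → Y b ≡ false) ×
  IsBasisOfSpan A (λ v → Y v ≡ true) (xvec G Y) ×
  IsBasisOfSpan B (λ v → Y v ≡ false) (xvec G (compl Y))

OrderedSplitPair : ∀ {n} → Graph n → VSet n → List (Fin n) → List (Fin n) → Set
OrderedSplitPair G Y ā b̄ = SplitPair G Y (Entry ā) (Entry b̄)

Equiv : ∀ {n} → Graph n → List (Fin n) → List (Fin n) → Fin n → Fin n → Set
Equiv G ā b̄ v w = ∀ u → (u ∈ ā ⊎ u ∈ b̄) → adj G v u ≡ adj G w u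

module Submission where

-- The vectors x_{X̄₁}(b), b ∈ b̄₁, span every x_{X̄₁}(u) with
-- u ∉ X₁, and the v-entry of x_{X̄₁}(u) is just the adjacency of u and v
-- (because v ∈ X₁).  Since v and w see every b ∈ b̄₁ alike, every vector in
-- that span has equal v- and w-entries; hence v and w have the same
-- neighbours in all of X̄₁ (lemma agreeOutside).
-- For the theorem take u ∈ ā₂ ∪ b̄₂.  If u ∉ X₁ we conclude by agreeOutside;
-- this covers all of ā₂ ⊆ X₂, as X₂ is disjoint from X₁.  If u ∈ X₁ then
-- u ∈ b̄₂ ∩ X₁ ⊆ ā₁, where v and w agree by assumption.

open import Defs
open import Data.Nat using (ℕ)
open import Data.Fin using (Fin; zero; suc)
open import Data.Bool using (Bool; true; false; not; _∧_; _xor_)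
open import Data.List using (List)
open import Data.List.Membership.Propositional using (_∈_)
open import Data.Product using (_,_)
open import Data.Sum using (inj₁; inj₂)
open import Relation.Binary.PropositionalEquality
  using (_≡_; refl; trans; cong; cong₂; module ≡-Reasoning)
  renaming (sym to ≡-sym)

⊕-cong : ∀ {k} {f g : Fin k → Bool} → (∀ i → f i ≡ g i) → ⊕ f ≡ ⊕ g
⊕-cong {k = ℕ.zero}  e = refl
⊕-cong {k = ℕ.suc k} e = cong₂ _xor_ (e zero) (⊕-cong (λ i → e (suc i)))

lincombAgreement : ∀ {n} (c : Fin n → Bool) (f : Fin n → Vec₂ n) (v w : Fin n)
  → (∀ b → c b ≡ true → f b v ≡ f b w)
  → lincomb c f v ≡ lincomb c f w
lincombAgreement c f v w agree = ⊕-cong termAgreement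
  where
  termAgreement : ∀ b → (c b ∧ f b v) ≡ (c b ∧ f b w)
  termAgreement b with c b in cb
  ... | false = refl
  ... | true  = agree b cb

spanAgreement : ∀ {n} (P : Fin n → Set) (f : Fin n → Vec₂ n) (v w : Fin n)
  → (∀ b → P b → f b v ≡ f b w)
  → ∀ z → InSpan P f z → z v ≡ z w
spanAgreement P f v w agree z (c , supported , combination) = begin
  z v             ≡⟨ ≡-sym (combination v) ⟩
  lincomb c f v   ≡⟨ lincombAgreement c f v w (λ b cb → agree b (supported b cb)) ⟩
  lincomb c f w   ≡⟨ combination w ⟩
  z w             ∎
  where open ≡-Reasoning

xvecComplEntry : ∀ {n} (G : Graph n) (Y : VSet n) (u v : Fin n)
  → Y v ≡ true → xvec G (compl Y) u v ≡ adj G u v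
xvecComplEntry G Y u v yv = begin
  not (not (Y v)) ∧ adj G u v  ≡⟨ cong (λ y → not (not y) ∧ adj G u v) yv ⟩
  true ∧ adj G u v             ≡⟨⟩
  adj G u v                    ∎
  where open ≡-Reasoning

agreeOutside : ∀ {n} (G : Graph n) (Y : VSet n) (B : Fin n → Set)
  → (∀ u → Y u ≡ false → InSpan B (xvec G (compl Y)) (xvec G (compl Y) u))
  → (v w : Fin n) → Y v ≡ true → Y w ≡ true
  → (∀ b → B b → adj G v b ≡ adj G w b)
  → ∀ u → Y u ≡ false → adj G v u ≡ adj G w u
agreeOutside G Y B spans v w yv yw agreeOnB u yu = begin
  adj G v u                   ≡⟨ Graph.sym G v u ⟩
  adj G u v                   ≡⟨ ≡-sym (xvecComplEntry G Y u v yv) ⟩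
  xvec G (compl Y) u v        ≡⟨ spanAgreement B (xvec G (compl Y)) v w
                                   generatorAgreement _ (spans u yu) ⟩
  xvec G (compl Y) u w        ≡⟨ xvecComplEntry G Y u w yw ⟩
  adj G u w                   ≡⟨ Graph.sym G u w ⟩
  adj G w u                   ∎
  where
  open ≡-Reasoning
  generatorAgreement : ∀ b → B b → xvec G (compl Y) b v ≡ xvec G (compl Y) b w
  generatorAgreement b bB = begin
    xvec G (compl Y) b v  ≡⟨ xvecComplEntry G Y b v yv ⟩
    adj G b v             ≡⟨ Graph.sym G b v ⟩
    adj G v b             ≡⟨ agreeOnB b bB ⟩
    adj G w b             ≡⟨ Graph.sym G w b ⟩
    adj G b w             ≡⟨ ≡-sym (xvecComplEntry G Y b w yw) ⟩
    xvec G (compl Y) b w  ∎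

disjointOutside : ∀ {n} (X₁ X₂ : VSet n)
  → (∀ u → X₁ u ≡ true → X₂ u ≡ false)
  → ∀ u → X₂ u ≡ true → X₁ u ≡ false
disjointOutside X₁ X₂ disjoint u x₂u with X₁ u in x₁u
... | false = refl
... | true  with trans (≡-sym x₂u) (disjoint u x₁u)
...   | ()

lemma5p8 : ∀ {n} (G : Graph n) (X₁ X₂ : VSet n)
    → (∀ u → X₁ u ≡ true → X₂ u ≡ false)
    → (ā₁ b̄₁ ā₂ b̄₂ : List (Fin n))
    → OrderedSplitPair G X₁ ā₁ b̄₁
    → OrderedSplitPair G X₂ ā₂ b̄₂
    → (∀ u → X₁ u ≡ true → u ∈ b̄₂ → u ∈ ā₁)
    → (v w : Fin n) → X₁ v ≡ true → X₁ w ≡ true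
    → Equiv G ā₁ b̄₁ v w
    → Equiv G ā₂ b̄₂ v w
lemma5p8 G X₁ X₂ disjoint ā₁ b̄₁ ā₂ b̄₂ (_ , _ , _ , b̄₁Spans , _) (ā₂⊆X₂ , _)
         b̄₂∩X₁⊆ā₁ v w x₁v x₁w v≈₁w = v≈₂w
  where
  outsideX₁ : ∀ u → X₁ u ≡ false → adj G v u ≡ adj G w u
  outsideX₁ = agreeOutside G X₁ (Entry b̄₁) b̄₁Spans v w x₁v x₁w
                (λ b b∈b̄₁ → v≈₁w b (inj₂ b∈b̄₁))

  v≈₂w : Equiv G ā₂ b̄₂ v w
  v≈₂w u (inj₁ u∈ā₂) = outsideX₁ u (disjointOutside X₁ X₂ disjoint u (ā₂⊆X₂ u u∈ā₂))
  v≈₂w u (inj₂ u∈b̄₂) with X₁ u in x₁u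
  ... | true  = v≈₁w u (inj₁ (b̄₂∩X₁⊆ā₁ u x₁u u∈b̄₂))
  ... | false = outsideX₁ u x₁u
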